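{- Let $G$ be a rooted DAG. Then for all $v\in V(G)$, $\mathrm{wt}_G(v)\le\mathrm{mul}_G(v)$.
   Context: A DAG is a finite directed acyclic graph. $\trianglelefteq$ is the reflexive transitive closure of the edge relation; $G$ is rooted with root $r$ if $r$ is the unique $\trianglelefteq$-minimal vertex. $\deg^-(u)$ denotes in-degree. For $v\in V(G)$, $\mathcal{P}_G(v)$ is the set of directed paths $(v_0,\dots,v_k)$, $k\ge0$, with $v_0=r$ and $v_k=v$. The weight is $\mathrm{wt}_G(v)=|\mathcal{P}_G(v)|$ and the multiplicity is $\mathrm{mul}_G(v)=\max\{\prod_{i=1}^k\deg^-(v_i):(v_0,\dots,v_k)\in\mathcal{P}_G(v)\}$ (empty product $=1$). -}

module Defs where

open import Data.Nat using (ℕ; zero; suc; _*_)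
open import Data.Fin using (Fin)
open import Data.Bool using (Bool; true; false)
open import Data.List using (List; []; _∷_; length; filter; map; _++_)
open import Data.Nat.ListAction using (product)
open import Data.Empty using (⊥)
open import Data.Fin.Base using ()
open import Data.List using () renaming (allFin to listAllFin)
open import Data.Product using (_×_; Σ)
open import Relation.Binary.PropositionalEquality using (_≡_)
open import Relation.Binary.Construct.Closure.ReflexiveTransitive using (Star)
open import Relation.Nullary using (¬_)
open import Data.Bool.Properties using (T?)
open import Data.Bool using (T)

Graph : ℕ → Set
Graph n = Fin n → Fin n → Bool

module _ {n : ℕ} (G : Graph n) where

  Edge : Fin n → Fin n → Set
  Edge u w = T (G u w)

  _⊴_ : Fin n → Fin n → Set
  _⊴_ = Star Edge

  Acyclic : Set
  Acyclic = ∀ u w → Edge u w → ¬ (w ⊴ u)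

  Minimal : Fin n → Set
  Minimal x = ∀ u → u ⊴ x → u ≡ x

  RootedAt : Fin n → Set
  RootedAt r = Minimal r × (∀ m → Minimal m → m ≡ r)

  indeg : Fin n → ℕ
  indeg u = length (filter (λ w → T? (G w u)) (listAllFin n))

  data PathTo : Fin n → List (Fin n) → Set where
    single : ∀ v → PathTo v (v ∷ [])
    step   : ∀ {u v vs} → PathTo u vs → Edge u v → PathTo v (vs ++ (v ∷ []))

  StartsAt : Fin n → List (Fin n) → Set
  StartsAt r [] = ⊥
  StartsAt r (x ∷ _) = x ≡ r

  IsRootPath : Fin n → Fin n → List (Fin n) → Set
  IsRootPath r v p = StartsAt r p × PathTo v p

  pathProd : List (Fin n) → ℕ
  pathProd [] = 1
  pathProd (_ ∷ vs) = product (map indeg vs)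

{-# OPTIONS --safe #-}
-- Induct along the relation "u reaches v by a nonempty walk", which is well founded because G is
-- finite and acyclic. The root has only the trivial root path. Any other vertex v has an
-- in-neighbour (otherwise it would be a second minimal vertex), and every root path to v is a root
-- path to some in-neighbour u followed by the edge u → v. Grouping distinct root paths to v by u,
-- the group of u has at most pathProd pᵤ members for some root path pᵤ to u, so in total there are
-- at most indeg v · maxᵤ pathProd pᵤ of them, which is pathProd of the heaviest pᵤ extended by v.
module Submission where

open import Defs
open import Data.Nat using (ℕ; _≤_; _<_; _*_; z≤n; s≤s)
open import Data.Nat.Properties
  using ( ≤-refl; ≤-trans; ≤-total; n≤1+n; +-mono-≤; +-mono-<-≤; +-mono-≤-<
        ; *-monoʳ-≤; *-comm; *-identityʳ; module ≤-Reasoning)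
open import Data.Nat.ListAction using (sum; product)
open import Data.Nat.ListAction.Properties using (product-++)
open import Data.Fin using (Fin; _≟_)
open import Data.Fin.Properties using (any?)
open import Data.Fin.Induction using (spo-wellFounded)
open import Data.List using (List; []; _∷_; _∷ʳ_; _++_; length; map; filter; allFin)
open import Data.List.Properties using (length-map; map-++)
open import Data.List.Relation.Unary.All as All using (All; []; _∷_)
open import Data.List.Relation.Unary.All.Properties as All using (all-filter)
open import Data.List.Relation.Unary.Any as Any using (Any; here; there)
open import Data.List.Relation.Unary.AllPairs as AllPairs using (_∷_)
import Data.List.Relation.Unary.AllPairs.Properties as AllPairs
open import Data.List.Relation.Unary.Unique.Propositional using (Unique)
open import Data.List.Membership.Propositional using (_∈_)
open import Data.List.Membership.Propositional.Properties using (∈-filter⁺; ∈-allFin)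
open import Data.Product using (Σ; ∃; ∃₂; _×_; _,_; proj₁)
open import Data.Sum using (inj₁; inj₂)
open import Data.Bool.Properties using (T?)
open import Function using (_∘_)
open import Level using (0ℓ)
open import Induction.WellFounded using (WellFounded; Acc; acc)
open import Relation.Binary using (Rel; DecidableEquality; IsStrictPartialOrder)
open import Relation.Binary.PropositionalEquality
open import Relation.Binary.Construct.Closure.ReflexiveTransitive using (Star; ε; _◅_; _◅◅_)
open import Relation.Nullary using (¬_; yes; no; contradiction)

module _ {A : Set} where

  unique∧all≡⇒length≤1 : ∀ {x : A} {xs} → Unique xs → All (_≡ x) xs → length xs ≤ 1
  unique∧all≡⇒length≤1 {xs = []}        _               _               = z≤n
  unique∧all≡⇒length≤1 {xs = _ ∷ []}    _               _               = ≤-refl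
  unique∧all≡⇒length≤1 {xs = _ ∷ _ ∷ _} ((y≢z ∷ _) ∷ _) (y≡x ∷ z≡x ∷ _) =
    contradiction (trans y≡x (sym z≡x)) y≢z

  sum-map-mono-≤ : ∀ {f g : A → ℕ} → (∀ x → f x ≤ g x) → ∀ xs → sum (map f xs) ≤ sum (map g xs)
  sum-map-mono-≤ f≤g []       = z≤n
  sum-map-mono-≤ f≤g (x ∷ xs) = +-mono-≤ (f≤g x) (sum-map-mono-≤ f≤g xs)

  sum-map-mono-< : ∀ {f g : A → ℕ} → (∀ x → f x ≤ g x) → ∀ {xs} → Any (λ x → f x < g x) xs →
                   sum (map f xs) < sum (map g xs)
  sum-map-mono-< f≤g {x ∷ xs} (here fx<gx) = +-mono-<-≤ fx<gx (sum-map-mono-≤ f≤g xs)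
  sum-map-mono-< f≤g {x ∷ xs} (there any<) = +-mono-≤-< (f≤g x) (sum-map-mono-< f≤g any<)

  sum≤length*heaviest : ∀ {B : A → Set} (c : A → ℕ) (w : ∀ {x} → B x → ℕ) {x₀} → B x₀ →
                        ∀ {xs} → All (λ x → Σ (B x) λ b → c x ≤ w b) xs →
                        ∃ λ y → Σ (B y) λ b → sum (map c xs) ≤ length xs * w b
  sum≤length*heaviest c w b₀ [] = _ , b₀ , z≤n
  sum≤length*heaviest c w b₀ {x ∷ xs} ((b , cx≤wb) ∷ bounds)
    with y , b′ , sum≤ ← sum≤length*heaviest c w b₀ bounds
       | ≤-total (w b) (w b′)
  ... | inj₁ wb≤wb′ = y , b′ , +-mono-≤ (≤-trans cx≤wb wb≤wb′) sum≤
  ... | inj₂ wb′≤wb = x , b , +-mono-≤ cx≤wb (≤-trans sum≤ (*-monoʳ-≤ (length xs) wb′≤wb))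

module Fibres {A B : Set} (_≟ᴬ_ : DecidableEquality A) (key : B → A) where

  fibre : A → List B → List B
  fibre a = filter (λ b → key b ≟ᴬ a)

  fibre-∷-≤ : ∀ b bs a → length (fibre a bs) ≤ length (fibre a (b ∷ bs))
  fibre-∷-≤ b bs a with key b ≟ᴬ a
  ... | yes _ = n≤1+n _
  ... | no  _ = ≤-refl

  fibre-∷-key : ∀ b bs → length (fibre (key b) bs) < length (fibre (key b) (b ∷ bs))
  fibre-∷-key b bs with key b ≟ᴬ key b
  ... | yes _   = ≤-refl
  ... | no  b≢b = contradiction refl b≢b

  length≤sum-fibres : ∀ (S : List A) bs → All (λ b → key b ∈ S) bs →
                      length bs ≤ sum (map (λ a → length (fibre a bs)) S)
  length≤sum-fibres S []       []           = z≤n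
  length≤sum-fibres S (b ∷ bs) (b∈S ∷ bs⊆S) =
    ≤-trans (s≤s (length≤sum-fibres S bs bs⊆S))
            (sum-map-mono-< (fibre-∷-≤ b bs) (Any.map (λ { refl → fibre-∷-key b bs }) b∈S))

module _ {n : ℕ} (G : Graph n) where

  infix 4 _≺_
  _≺_ : Rel (Fin n) 0ℓ
  u ≺ v = ∃ λ w → Edge G u w × Star (Edge G) w v

  ≺-isStrictPartialOrder : Acyclic G → IsStrictPartialOrder _≡_ _≺_
  ≺-isStrictPartialOrder acyclic = record
    { isEquivalence = isEquivalence
    ; irrefl        = λ { refl (w , e , s) → acyclic _ w e s }
    ; trans         = λ { (w , e , s) (_ , e′ , s′) → w , e , s ◅◅ e′ ◅ s′ }
    ; <-resp-≈      = resp₂ _≺_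
    }

  ≺-wellFounded : Acyclic G → WellFounded _≺_
  ≺-wellFounded = spo-wellFounded ∘ ≺-isStrictPartialOrder

  noInEdge⇒minimal : ∀ {v} → (∀ u → ¬ Edge G u v) → Minimal G v
  noInEdge⇒minimal ∄e _ ε = refl
  noInEdge⇒minimal ∄e u (e ◅ s) with refl ← noInEdge⇒minimal ∄e _ s = contradiction e (∄e u)

  inNeighbour : ∀ {r v} → RootedAt G r → v ≢ r → ∃ λ u → Edge G u v
  inNeighbour {v = v} (_ , minimal⇒r) v≢r with any? (λ u → T? (G u v))
  ... | yes in-edge = in-edge
  ... | no  ∄e      = contradiction (minimal⇒r v (noInEdge⇒minimal (λ u e → ∄e (u , e)))) v≢r

  inNeighbours : Fin n → List (Fin n)
  inNeighbours v = filter (λ u → T? (G u v)) (allFin n)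

  inNeighbours-edges : ∀ v → All (λ u → Edge G u v) (inNeighbours v)
  inNeighbours-edges v = all-filter (λ u → T? (G u v)) (allFin n)

  ∈-inNeighbours : ∀ {u v} → Edge G u v → u ∈ inNeighbours v
  ∈-inNeighbours {v = v} = ∈-filter⁺ (λ u → T? (G u v)) (∈-allFin _)

  pathTo-∷ : ∀ {v p} → PathTo G v p → ∃₂ λ x xs → p ≡ x ∷ xs
  pathTo-∷ (single v)   = v , [] , refl
  pathTo-∷ (step path _) with x , xs , refl ← pathTo-∷ path = x , _ , refl

  pathProd-∷ʳ : ∀ x xs v → pathProd G (x ∷ xs ∷ʳ v) ≡ pathProd G (x ∷ xs) * indeg G v
  pathProd-∷ʳ x xs v = begin
    product (map (indeg G) (xs ∷ʳ v))               ≡⟨ cong product (map-++ (indeg G) xs (v ∷ [])) ⟩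
    product (map (indeg G) xs ∷ʳ indeg G v)         ≡⟨ product-++ (map (indeg G) xs) (indeg G v ∷ []) ⟩
    product (map (indeg G) xs) * (indeg G v * 1)    ≡⟨ cong (product (map (indeg G) xs) *_) (*-identityʳ _) ⟩
    product (map (indeg G) xs) * indeg G v          ∎
    where open ≡-Reasoning

  module _ {r : Fin n} where

    startsAt-++ : ∀ {p} q → StartsAt G r p → StartsAt G r (p ++ q)
    startsAt-++ {_ ∷ _} _ st = st

    startsAt-++⁻ : ∀ {u p q} → PathTo G u p → StartsAt G r (p ++ q) → StartsAt G r p
    startsAt-++⁻ path st with _ , _ , refl ← pathTo-∷ path = st

    rootPath-∷ʳ : ∀ {u v p} → IsRootPath G r u p → Edge G u v → IsRootPath G r v (p ∷ʳ v)
    rootPath-∷ʳ (st , path) e = startsAt-++ _ st , step path e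

    rootPath⇒⊴ : ∀ {v p} → StartsAt G r p → PathTo G v p → Star (Edge G) r v
    rootPath⇒⊴ refl (single _)    = ε
    rootPath⇒⊴ st   (step path e) = rootPath⇒⊴ (startsAt-++⁻ path st) path ◅◅ e ◅ ε

    rootPath-root : Acyclic G → ∀ {p} → IsRootPath G r r p → p ≡ r ∷ []
    rootPath-root _       (_ , single _)     = refl
    rootPath-root acyclic (st , step path e) =
      contradiction (rootPath⇒⊴ (startsAt-++⁻ path st) path) (acyclic _ r e)

    record LastStep (v : Fin n) : Set where
      constructor lastStep
      field
        {source}   : Fin n
        {prefix}   : List (Fin n)
        edge       : Edge G source v
        prefixPath : IsRootPath G r source prefix

      path : List (Fin n)
      path = prefix ∷ʳ v

    open LastStep public

    rootPath-lastStep : ∀ {v p} → v ≢ r → IsRootPath G r v p → Σ (LastStep v) λ s → path s ≡ p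
    rootPath-lastStep v≢r (v≡r , single _)   = contradiction v≡r v≢r
    rootPath-lastStep _   (st , step path e) = lastStep e (startsAt-++⁻ path st , path) , refl

    rootPaths-lastSteps : ∀ {v L} → v ≢ r → All (IsRootPath G r v) L →
                          Σ (List (LastStep v)) λ Q → map path Q ≡ L
    rootPaths-lastSteps v≢r []         = [] , refl
    rootPaths-lastSteps v≢r (rp ∷ rps)
      with s , refl ← rootPath-lastStep v≢r rp
         | Q , refl ← rootPaths-lastSteps v≢r rps = s ∷ Q , refl

    module _ {v : Fin n} where
      open Fibres _≟_ (source {v}) public

      fibre-prefixes-unique : ∀ {Q} u → Unique (map path Q) → Unique (map prefix (fibre u Q))
      fibre-prefixes-unique u =
        AllPairs.map⁺ ∘ AllPairs.filter⁺ _ ∘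
        AllPairs.map (λ paths≢ prefixes≡ → paths≢ (cong (_∷ʳ v) prefixes≡)) ∘ AllPairs.map⁻

      fibre-prefixes-rootPaths : ∀ {Q} u → All (IsRootPath G r u) (map prefix (fibre u Q))
      fibre-prefixes-rootPaths {Q} u =
        All.map⁺ (All.map (λ { {s} refl → prefixPath s }) (all-filter (λ s → source s ≟ u) Q))

module _ {n : ℕ} {G : Graph n} {r : Fin n} where

  Wt≤Mul : Fin n → Set
  Wt≤Mul v = ∀ L → Unique L → All (IsRootPath G r v) L →
             Σ (List (Fin n)) λ p → IsRootPath G r v p × length L ≤ pathProd G p

  wt≤mul-root : Acyclic G → Wt≤Mul r
  wt≤mul-root acyclic L unique rootPaths =
    r ∷ [] , (refl , single r) , unique∧all≡⇒length≤1 unique (All.map (rootPath-root G acyclic) rootPaths)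

  module _ {v : Fin n} (ih : ∀ {u} → Edge G u v → Wt≤Mul u)
           (Q : List (LastStep G {r} v)) (unique : Unique (map path Q)) where

    RootedInEdge : Fin n → Set
    RootedInEdge u = Edge G u v × ∃ (IsRootPath G r u)

    weight : ∀ {u} → RootedInEdge u → ℕ
    weight (_ , p , _) = pathProd G p

    fibre≤weight : ∀ {u} → Edge G u v → Σ (RootedInEdge u) λ b → length (fibre G u Q) ≤ weight b
    fibre≤weight {u} e
      with p , rp , bound ← ih e _ (fibre-prefixes-unique G {Q = Q} u unique)
                                   (fibre-prefixes-rootPaths G {Q = Q} u)
      = (e , p , rp) , subst (_≤ pathProd G p) (length-map prefix (fibre G u Q)) bound

    wt≤mul-lastSteps : ∀ {u₀} → Edge G u₀ v →
                       Σ (List (Fin n)) λ p → IsRootPath G r v p × length (map path Q) ≤ pathProd G p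
    wt≤mul-lastSteps e₀
      with _ , (e , p@(x ∷ xs) , rp) , sum≤ ←
             sum≤length*heaviest (λ u → length (fibre G u Q)) weight
               (proj₁ (fibre≤weight e₀)) (All.map fibre≤weight (inNeighbours-edges G v))
      = p ∷ʳ v , rootPath-∷ʳ G rp e , (begin
        length (map path Q)                                        ≡⟨ length-map path Q ⟩
        length Q                                                   ≤⟨ length≤sum-fibres G (inNeighbours G v) Q
                                                                        (All.universal (∈-inNeighbours G ∘ edge) Q) ⟩
        sum (map (λ u → length (fibre G u Q)) (inNeighbours G v))  ≤⟨ sum≤ ⟩
        indeg G v * pathProd G p                                   ≡⟨ *-comm (indeg G v) _ ⟩
        pathProd G p * indeg G v                                   ≡⟨ pathProd-∷ʳ G x xs v ⟨
        pathProd G (p ∷ʳ v)                                        ∎)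
      where open ≤-Reasoning

  wt≤mul : Acyclic G → RootedAt G r → ∀ {v} → Acc (_≺_ G) v → Wt≤Mul v
  wt≤mul acyclic rooted {v} (acc below) L unique rootPaths with v ≟ r
  ... | yes refl = wt≤mul-root acyclic L unique rootPaths
  ... | no  v≢r
    with Q , refl ← rootPaths-lastSteps G v≢r rootPaths
    with _ , e₀ ← inNeighbour G rooted v≢r
    = wt≤mul-lastSteps (λ e → wt≤mul acyclic rooted (below (_ , e , ε))) Q unique e₀

lemma2 : (n : ℕ) (G : Graph n) (r : Fin n) → Acyclic G → RootedAt G r →
    (v : Fin n) (L : List (List (Fin n))) → Unique L → All (IsRootPath G r v) L →
    Σ (List (Fin n)) (λ p → IsRootPath G r v p × length L ≤ pathProd G p)
lemma2 n G r acyclic rooted v = wt≤mul acyclic rooted (≺-wellFounded G acyclic v)
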